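{- For $n\ge 3$, the unidirectional cycle $\overrightarrow{C_n}$ is $\{0,1\}$-antimagic.
   Context: The unidirectional cycle $\overrightarrow{C_n}$ has vertices $v_1,\dots,v_n$ and arcs $(v_i,v_{i+1})$ for $1\le i\le n-1$ and $(v_n,v_1)$, so $d(v_i,v_j)=(j-i)\bmod n$, where $d(u,y)$ is the length of a shortest directed path. $N_D(v)=\{y:d(v,y)\in D\}$; a bijection $f:V\to\{1,\dots,n\}$ is $D$-antimagic if $\omega_D(v)=\sum_{y\in N_D(v)}f(y)$ are pairwise distinct; the graph is $D$-antimagic if such a bijection exists. -}

module Defs where

open import Data.Nat using (ℕ; zero; suc; _+_; _∸_; _%_; NonZero)
open import Data.Nat.Properties using (_≟_)
open import Data.Fin using (Fin; toℕ)
open import Data.List using (List; []; _∷_; map; filter; allFin)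
open import Data.Nat.ListAction using (sum)
open import Data.List.Membership.DecPropositional _≟_ using (_∈_; _∈?_)
open import Data.Product using (Σ)
open import Function.Bundles using (_↔_; Inverse)
open import Function.Definitions using (Injective)
open import Relation.Binary.PropositionalEquality using (_≡_)

-- Unidirectional cycle C_n with vertices v_1..v_n represented as Fin n
-- (v_{i+1} ↔ i).  Arcs (v_i, v_{i+1}) and (v_n, v_1).
-- Shortest directed path length: d(v_i, v_j) = (j - i) mod n.
dist : (n : ℕ) → .{{NonZero n}} → Fin n → Fin n → ℕ
dist n i j = (toℕ j + n ∸ toℕ i) % n

ND : (n : ℕ) → .{{NonZero n}} → List ℕ → Fin n → List (Fin n)
ND n D v = filter (λ y → dist n v y ∈? D) (allFin n)

label : {n : ℕ} → (Fin n ↔ Fin n) → Fin n → ℕ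
label σ y = suc (toℕ (Inverse.to σ y))

weight : (n : ℕ) → .{{NonZero n}} → List ℕ → (Fin n ↔ Fin n) → Fin n → ℕ
weight n D σ v = sum (map (label σ) (ND n D v))

IsDAntimagicLabeling : (n : ℕ) → .{{NonZero n}} → List ℕ → (Fin n ↔ Fin n) → Set
IsDAntimagicLabeling n D σ = Injective _≡_ _≡_ (weight n D σ)

CycleDAntimagic : (n : ℕ) → .{{NonZero n}} → List ℕ → Set
CycleDAntimagic n D = Σ (Fin n ↔ Fin n) (IsDAntimagicLabeling n D)

-- The {0,1}-neighbourhood of v_i is {v_i, v_{i+1}}, so ω(v_i) = f(v_i) + f(v_{i+1}).
-- For odd n the labelling f(v_i) = i gives the odd weights 2i + 1 (i < n) and the
-- even weight n + 1 at v_n.  For even n, swapping the labels of v_{n-1} and v_n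
-- gives the odd weights 2i + 1 for i ≤ n - 3 and 2n - 1 at v_{n-1}, and the
-- distinct even weights 2n - 2 at v_{n-2} and n at v_n.  An odd weight 2i + 1
-- determines i, and no odd weight equals an even one.
module Submission where

open import Defs
open import Level using (Level)
open import Data.Bool using (if_then_else_)
open import Data.Nat using (ℕ; zero; suc; _+_; _*_; _∸_; _%_; _≤_; _<_; z≤n; s≤s; s≤s⁻¹; NonZero)
open import Data.Nat.Properties
open import Data.Nat.DivMod using (m%n<n; n%n≡0; m<n⇒m%n≡m; m%n%n≡m%n; [m+n]%n≡m%n; %-distribˡ-+)
open import Data.Nat.ListAction using (sum)
open import Data.Nat.Tactic.RingSolver using (solve-∀)
open import Data.Fin using (Fin; toℕ; fromℕ; fromℕ<; inject₁; zero; suc) renaming (_≟_ to _≟ᶠ_)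
open import Data.Fin.Properties using (toℕ-fromℕ; toℕ-fromℕ<; toℕ-inject₁; toℕ-injective; toℕ<n)
import Data.Fin.Properties as Fin
import Data.Fin.Permutation as Perm
open import Data.Fin.Permutation.Components using (transpose)
open import Data.List using (List; []; _∷_; map; filter; allFin; tabulate)
open import Data.List.Properties using (map-tabulate; map-cong)
open import Data.List.Relation.Unary.Any using (here; there)
open import Data.List.Membership.DecPropositional _≟_ using (_∈_; _∈?_)
open import Data.Product using (∃-syntax; _×_; _,_)
open import Data.Sum using (_⊎_; inj₁; inj₂; [_,_]′)
open import Data.Empty using (⊥-elim)
open import Function.Base using (_∘_; id)
open import Function.Definitions using (Injective)
open import Function.Construct.Identity using (↔-id)
open import Relation.Nullary using (does; yes; no)
open import Relation.Nullary.Decidable using (dec-true; dec-false)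
open import Relation.Unary using (Pred; Decidable)
open import Relation.Binary.PropositionalEquality
open import Algebra.Properties.CommutativeSemigroup +-commutativeSemigroup using (interchange)

private
  variable
    a p : Level
    A : Set a

sum-map-filter : {P : Pred A p} (P? : Decidable P) (g : A → ℕ) (xs : List A) →
                 sum (map g (filter P? xs)) ≡ sum (map (λ x → if does (P? x) then g x else 0) xs)
sum-map-filter P? g []       = refl
sum-map-filter P? g (x ∷ xs) with P? x
... | yes _ = cong (g x +_) (sum-map-filter P? g xs)
... | no  _ = sum-map-filter P? g xs

sum-map-+ : (f g : A → ℕ) (xs : List A) →
            sum (map (λ x → f x + g x) xs) ≡ sum (map f xs) + sum (map g xs)
sum-map-+ f g []       = refl
sum-map-+ f g (x ∷ xs) = trans (cong (f x + g x +_) (sum-map-+ f g xs)) (interchange (f x) (g x) _ _)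

sum-tabulate-≡0 : ∀ {n} (h : Fin n → ℕ) → (∀ y → h y ≡ 0) → sum (tabulate h) ≡ 0
sum-tabulate-≡0 {zero}  h h≡0 = refl
sum-tabulate-≡0 {suc n} h h≡0 rewrite h≡0 zero = sum-tabulate-≡0 (h ∘ suc) (h≡0 ∘ suc)

sum-tabulate-single : ∀ {n} (h : Fin n → ℕ) (b : Fin n) → (∀ y → y ≢ b → h y ≡ 0) →
                      sum (tabulate h) ≡ h b
sum-tabulate-single h zero    h≡0 =
  trans (cong (h zero +_) (sum-tabulate-≡0 (h ∘ suc) (λ y → h≡0 (suc y) λ ()))) (+-identityʳ _)
sum-tabulate-single h (suc b) h≡0 rewrite h≡0 zero (λ ()) =
  sum-tabulate-single (h ∘ suc) b (λ y y≢b → h≡0 (suc y) (y≢b ∘ Fin.suc-injective))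

sum-allFin-indicator : ∀ {n} (g : Fin n → ℕ) (b : Fin n) →
                       sum (map (λ y → if does (y ≟ᶠ b) then g y else 0) (allFin n)) ≡ g b
sum-allFin-indicator {n} g b = begin
  sum (map δ (allFin n)) ≡⟨ cong sum (map-tabulate id δ) ⟩
  sum (tabulate δ)       ≡⟨ sum-tabulate-single δ b δ≡0 ⟩
  δ b                    ≡⟨ cong (if_then g b else 0) (dec-true (b ≟ᶠ b) refl) ⟩
  g b                    ∎
  where
  open ≡-Reasoning
  δ : Fin n → ℕ
  δ y = if does (y ≟ᶠ b) then g y else 0
  δ≡0 : ∀ y → y ≢ b → δ y ≡ 0
  δ≡0 y y≢b = cong (if_then g y else 0) (dec-false (y ≟ᶠ b) y≢b)

sum-filter-allFin-pair : ∀ {n} {P : Pred (Fin n) p} (P? : Decidable P) (g : Fin n → ℕ) {b c : Fin n} →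
                         b ≢ c → P b → P c → (∀ {y} → P y → y ≡ b ⊎ y ≡ c) →
                         sum (map g (filter P? (allFin n))) ≡ g b + g c
sum-filter-allFin-pair {n = n} P? g {b} {c} b≢c Pb Pc P⇒ = begin
  sum (map g (filter P? (allFin n)))                            ≡⟨ sum-map-filter P? g (allFin n) ⟩
  sum (map (λ y → if does (P? y) then g y else 0) (allFin n))   ≡⟨ cong sum (map-cong split (allFin n)) ⟩
  sum (map (λ y → δ b y + δ c y) (allFin n))                    ≡⟨ sum-map-+ (δ b) (δ c) (allFin n) ⟩
  sum (map (δ b) (allFin n)) + sum (map (δ c) (allFin n))       ≡⟨ cong₂ _+_ (sum-allFin-indicator g b) (sum-allFin-indicator g c) ⟩
  g b + g c                                                     ∎
  where
  open ≡-Reasoning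
  δ : Fin n → Fin n → ℕ
  δ x y = if does (y ≟ᶠ x) then g y else 0
  split : ∀ y → (if does (P? y) then g y else 0) ≡ δ b y + δ c y
  split y with P? y | y ≟ᶠ b | y ≟ᶠ c
  ... | _     | yes refl | yes refl = ⊥-elim (b≢c refl)
  ... | yes _ | yes _    | no _     = sym (+-identityʳ (g y))
  ... | yes _ | no _     | yes _    = refl
  ... | yes q | no y≢b   | no y≢c   = [ ⊥-elim ∘ y≢b , ⊥-elim ∘ y≢c ]′ (P⇒ q)
  ... | no ¬q | yes refl | _        = ⊥-elim (¬q Pb)
  ... | no ¬q | no _     | yes refl = ⊥-elim (¬q Pc)
  ... | no _  | no _     | no _     = refl

module _ {n : ℕ} .{{_ : NonZero n}} where

  [m+k%n]%n≡[m+k]%n : ∀ m k → (m + k % n) % n ≡ (m + k) % n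
  [m+k%n]%n≡[m+k]%n m k = begin
    (m + k % n) % n         ≡⟨ %-distribˡ-+ m (k % n) n ⟩
    (m % n + k % n % n) % n ≡⟨ cong (λ x → (m % n + x) % n) (m%n%n≡m%n k n) ⟩
    (m % n + k % n) % n     ≡⟨ %-distribˡ-+ m k n ⟨
    (m + k) % n             ∎
    where open ≡-Reasoning

  dist≡⇒toℕ≡ : ∀ {v y : Fin n} {d} → dist n v y ≡ d → toℕ y ≡ (toℕ v + d) % n
  dist≡⇒toℕ≡ {v} {y} {d} refl = begin
    toℕ y                             ≡⟨ m<n⇒m%n≡m (toℕ<n y) ⟨
    toℕ y % n                         ≡⟨ [m+n]%n≡m%n (toℕ y) n ⟨
    (toℕ y + n) % n                   ≡⟨ cong (_% n) (m+[n∸m]≡n i≤j+n) ⟨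
    (toℕ v + (toℕ y + n ∸ toℕ v)) % n ≡⟨ [m+k%n]%n≡[m+k]%n (toℕ v) _ ⟨
    (toℕ v + dist n v y) % n          ∎
    where
    open ≡-Reasoning
    i≤j+n : toℕ v ≤ toℕ y + n
    i≤j+n = ≤-trans (<⇒≤ (toℕ<n v)) (m≤n+m n (toℕ y))

  toℕ≡⇒dist≡ : ∀ {v y : Fin n} {d} → d < n → toℕ y ≡ (toℕ v + d) % n → dist n v y ≡ d
  toℕ≡⇒dist≡ {v} {y} {d} d<n y≡v+d = begin
    (toℕ y + n ∸ i) % n         ≡⟨ cong (_% n) (+-∸-assoc (toℕ y) i≤n) ⟩
    (toℕ y + (n ∸ i)) % n       ≡⟨ cong (_% n) (+-comm (toℕ y) (n ∸ i)) ⟩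
    (n ∸ i + toℕ y) % n         ≡⟨ cong (λ x → (n ∸ i + x) % n) y≡v+d ⟩
    (n ∸ i + (i + d) % n) % n   ≡⟨ [m+k%n]%n≡[m+k]%n (n ∸ i) (i + d) ⟩
    (n ∸ i + (i + d)) % n       ≡⟨ cong (_% n) (+-assoc (n ∸ i) i d) ⟨
    (n ∸ i + i + d) % n         ≡⟨ cong (λ x → (x + d) % n) (m∸n+n≡m i≤n) ⟩
    (n + d) % n                 ≡⟨ cong (_% n) (+-comm n d) ⟩
    (d + n) % n                 ≡⟨ [m+n]%n≡m%n d n ⟩
    d % n                       ≡⟨ m<n⇒m%n≡m d<n ⟩
    d                           ∎
    where
    open ≡-Reasoning
    i = toℕ v
    i≤n : i ≤ n
    i≤n = <⇒≤ (toℕ<n v)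

  next : Fin n → Fin n
  next v = fromℕ< (m%n<n (suc (toℕ v)) n)

  toℕ-next : ∀ v → toℕ (next v) ≡ suc (toℕ v) % n
  toℕ-next v = toℕ-fromℕ< (m%n<n (suc (toℕ v)) n)

  toℕ-next-< : ∀ {v} → suc (toℕ v) < n → toℕ (next v) ≡ suc (toℕ v)
  toℕ-next-< {v} 1+v<n = trans (toℕ-next v) (m<n⇒m%n≡m 1+v<n)

  toℕ-next-last : ∀ {v} → suc (toℕ v) ≡ n → toℕ (next v) ≡ 0
  toℕ-next-last {v} 1+v≡n = trans (toℕ-next v) (trans (cong (_% n) 1+v≡n) (n%n≡0 n))

  dist-self : ∀ v → dist n v v ≡ 0
  dist-self v = trans (cong (_% n) (m+n∸m≡n (toℕ v) n)) (n%n≡0 n)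

  dist-next : 1 < n → ∀ v → dist n v (next v) ≡ 1
  dist-next 1<n v = toℕ≡⇒dist≡ 1<n (trans (toℕ-next v) (cong (_% n) (+-comm 1 (toℕ v))))

  dist≡0⇒≡ : ∀ {v y} → dist n v y ≡ 0 → y ≡ v
  dist≡0⇒≡ {v} {y} eq = toℕ-injective (begin
    toℕ y             ≡⟨ dist≡⇒toℕ≡ eq ⟩
    (toℕ v + 0) % n   ≡⟨ cong (_% n) (+-identityʳ (toℕ v)) ⟩
    toℕ v % n         ≡⟨ m<n⇒m%n≡m (toℕ<n v) ⟩
    toℕ v             ∎)
    where open ≡-Reasoning

  dist≡1⇒≡next : ∀ {v y} → dist n v y ≡ 1 → y ≡ next v
  dist≡1⇒≡next {v} eq =
    toℕ-injective (trans (dist≡⇒toℕ≡ eq) (trans (cong (_% n) (+-comm (toℕ v) 1)) (sym (toℕ-next v))))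

  next≢ : 1 < n → ∀ v → v ≢ next v
  next≢ 1<n v v≡next = 0≢1+n (trans (sym (dist-self v)) (trans (cong (dist n v) v≡next) (dist-next 1<n v)))

  weight-01 : 1 < n → ∀ σ v → weight n (0 ∷ 1 ∷ []) σ v ≡ label σ v + label σ (next v)
  weight-01 1<n σ v = sum-filter-allFin-pair (λ y → dist n v y ∈? (0 ∷ 1 ∷ [])) (label σ)
    (next≢ 1<n v) (here (dist-self v)) (there (here (dist-next 1<n v))) neighbour
    where
    neighbour : ∀ {y} → dist n v y ∈ (0 ∷ 1 ∷ []) → y ≡ v ⊎ y ≡ next v
    neighbour (here d≡0)         = inj₁ (dist≡0⇒≡ d≡0)
    neighbour (there (here d≡1)) = inj₂ (dist≡1⇒≡next d≡1)

1+m+[2+m]≡3+2*m : ∀ m → suc m + suc (suc m) ≡ 3 + 2 * m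
1+m+[2+m]≡3+2*m = solve-∀

3+2*m+1≡2*[2+m] : ∀ m → (3 + 2 * m) + 1 ≡ 2 * (2 + m)
3+2*m+1≡2*[2+m] = solve-∀

[2+2*m]+[4+2*m]≡2*[3+2*m] : ∀ m → (2 + 2 * m) + (4 + 2 * m) ≡ 2 * (3 + 2 * m)
[2+2*m]+[4+2*m]≡2*[3+2*m] = solve-∀

[4+2*m]+[3+2*m]≡3+2*[2+2*m] : ∀ m → (4 + 2 * m) + (3 + 2 * m) ≡ 3 + 2 * (2 + 2 * m)
[4+2*m]+[3+2*m]≡3+2*[2+2*m] = solve-∀

≤2+-cases : ∀ {i k} → i ≤ 2 + k → i < k ⊎ i ≡ k ⊎ i ≡ 1 + k ⊎ i ≡ 2 + k
≤2+-cases i≤2+k with m≤n⇒m<n∨m≡n i≤2+k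
... | inj₂ i≡2+k = inj₂ (inj₂ (inj₂ i≡2+k))
... | inj₁ (s≤s i≤1+k) with m≤n⇒m<n∨m≡n i≤1+k
...   | inj₂ i≡1+k = inj₂ (inj₂ (inj₁ i≡1+k))
...   | inj₁ (s≤s i≤k) with m≤n⇒m<n∨m≡n i≤k
...     | inj₂ i≡k = inj₂ (inj₁ i≡k)
...     | inj₁ i<k = inj₁ i<k

even⊎odd : ∀ m → ∃[ t ] m ≡ 2 * t ⊎ ∃[ t ] m ≡ 1 + 2 * t
even⊎odd zero    = inj₁ (0 , refl)
even⊎odd (suc m) with even⊎odd m
... | inj₁ (t , refl) = inj₂ (t , refl)
... | inj₂ (t , refl) = inj₁ (suc t , sym (*-distribˡ-+ 2 1 t))

3+2*m≢2*n : ∀ m n → 3 + 2 * m ≢ 2 * n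
3+2*m≢2*n m n eq = even≢odd n (suc m) (trans (sym eq) (cong suc (sym (*-distribˡ-+ 2 1 m))))

transpose-matchˡ : ∀ {n} (i j : Fin n) → transpose i j i ≡ j
transpose-matchˡ i j rewrite dec-true (i ≟ᶠ i) refl = refl

transpose-matchʳ : ∀ {n} (i j : Fin n) → transpose i j j ≡ i
transpose-matchʳ i j with j ≟ᶠ i
... | yes j≡i = j≡i
... | no _ rewrite dec-true (j ≟ᶠ j) refl = refl

transpose-mismatch : ∀ {n} {i j k : Fin n} → k ≢ i → k ≢ j → transpose i j k ≡ k
transpose-mismatch {i = i} {j} {k} k≢i k≢j rewrite dec-false (k ≟ᶠ i) k≢i | dec-false (k ≟ᶠ j) k≢j = refl

-- Vertices are indexed from 0 (v_{i+1} is i), so the odd weights 2i + 1 become 3 + 2i.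
injective-by-parity : ∀ {n} (W : Fin n → ℕ) (decode : ℕ → ℕ) →
  (∀ v → W v ≡ 3 + 2 * toℕ v ⊎ ∃[ h ] (W v ≡ 2 * h × toℕ v ≡ decode h)) →
  Injective _≡_ _≡_ W
injective-by-parity W decode classify {v} {w} Wv≡Ww with classify v | classify w
... | inj₁ p | inj₁ q =
  toℕ-injective (*-cancelˡ-≡ _ _ 2 (+-cancelˡ-≡ 3 _ _ (trans (sym p) (trans Wv≡Ww q))))
... | inj₁ p | inj₂ (h , q , _) = ⊥-elim (3+2*m≢2*n (toℕ v) h (trans (sym p) (trans Wv≡Ww q)))
... | inj₂ (h , p , _) | inj₁ q = ⊥-elim (3+2*m≢2*n (toℕ w) h (trans (sym q) (trans (sym Wv≡Ww) p)))
... | inj₂ (h , p , v≡) | inj₂ (h′ , q , w≡) =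
  toℕ-injective (trans v≡ (trans (cong decode (*-cancelˡ-≡ h h′ 2 (trans (sym p) (trans Wv≡Ww q)))) (sym w≡)))

odd-cycle-01-antimagic : ∀ t → CycleDAntimagic (3 + 2 * t) (0 ∷ 1 ∷ [])
odd-cycle-01-antimagic t = σ , injective-by-parity W (λ _ → 2 + 2 * t) classify
  where
  n = 3 + 2 * t
  σ = ↔-id (Fin n)
  W = weight n (0 ∷ 1 ∷ []) σ
  classify : ∀ v → W v ≡ 3 + 2 * toℕ v ⊎ ∃[ h ] (W v ≡ 2 * h × toℕ v ≡ 2 + 2 * t)
  classify v with m≤n⇒m<n∨m≡n (toℕ<n v)
  ... | inj₁ 1+v<n = inj₁ (begin
    W v                               ≡⟨ weight-01 (s≤s (s≤s z≤n)) σ v ⟩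
    suc (toℕ v) + suc (toℕ (next v))  ≡⟨ cong (λ x → suc (toℕ v) + suc x) (toℕ-next-< 1+v<n) ⟩
    suc (toℕ v) + suc (suc (toℕ v))   ≡⟨ 1+m+[2+m]≡3+2*m (toℕ v) ⟩
    3 + 2 * toℕ v                     ∎)
    where open ≡-Reasoning
  ... | inj₂ 1+v≡n = inj₂ (2 + t , (begin
    W v                               ≡⟨ weight-01 (s≤s (s≤s z≤n)) σ v ⟩
    suc (toℕ v) + suc (toℕ (next v))  ≡⟨ cong₂ (λ x y → suc x + suc y) (suc-injective 1+v≡n) (toℕ-next-last 1+v≡n) ⟩
    (3 + 2 * t) + 1                   ≡⟨ 3+2*m+1≡2*[2+m] t ⟩
    2 * (2 + t)                       ∎) , suc-injective 1+v≡n)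
    where open ≡-Reasoning

even-cycle-01-antimagic : ∀ t → CycleDAntimagic (4 + 2 * t) (0 ∷ 1 ∷ [])
even-cycle-01-antimagic t = σ , injective-by-parity W decode classify
  where
  open ≡-Reasoning
  n = 4 + 2 * t
  penultimate last : Fin n
  penultimate = inject₁ (fromℕ (2 + 2 * t))
  last       = fromℕ (3 + 2 * t)
  σ = Perm.transpose penultimate last
  W = weight n (0 ∷ 1 ∷ []) σ

  toℕ-penultimate : toℕ penultimate ≡ 2 + 2 * t
  toℕ-penultimate = trans (toℕ-inject₁ (fromℕ (2 + 2 * t))) (toℕ-fromℕ (2 + 2 * t))

  label-penultimate : ∀ {y} → toℕ y ≡ 2 + 2 * t → label σ y ≡ 4 + 2 * t
  label-penultimate {y} y≡ rewrite toℕ-injective (trans y≡ (sym toℕ-penultimate)) =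
    cong suc (trans (cong toℕ (transpose-matchˡ penultimate last)) (toℕ-fromℕ (3 + 2 * t)))

  label-last : ∀ {y} → toℕ y ≡ 3 + 2 * t → label σ y ≡ 3 + 2 * t
  label-last {y} y≡ rewrite toℕ-injective (trans y≡ (sym (toℕ-fromℕ (3 + 2 * t)))) =
    cong suc (trans (cong toℕ (transpose-matchʳ penultimate last)) toℕ-penultimate)

  label-initial : ∀ {y} → toℕ y < 2 + 2 * t → label σ y ≡ suc (toℕ y)
  label-initial {y} y< = cong (suc ∘ toℕ) (transpose-mismatch y≢penultimate y≢last)
    where
    y≢penultimate : y ≢ penultimate
    y≢penultimate y≡ = <⇒≢ y< (trans (cong toℕ y≡) toℕ-penultimate)
    y≢last : y ≢ last
    y≢last y≡ = <⇒≢ (m<n⇒m<1+n y<) (trans (cong toℕ y≡) (toℕ-fromℕ (3 + 2 * t)))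

  weight-initial : ∀ {v} → toℕ v < 1 + 2 * t → W v ≡ 3 + 2 * toℕ v
  weight-initial {v} v< = begin
    W v                                 ≡⟨ weight-01 (s≤s (s≤s z≤n)) σ v ⟩
    label σ v + label σ (next v)        ≡⟨ cong₂ _+_ (label-initial (m<n⇒m<1+n v<)) (label-initial next<) ⟩
    suc (toℕ v) + suc (toℕ (next v))    ≡⟨ cong (λ x → suc (toℕ v) + suc x) toℕ-next-v ⟩
    suc (toℕ v) + suc (suc (toℕ v))     ≡⟨ 1+m+[2+m]≡3+2*m (toℕ v) ⟩
    3 + 2 * toℕ v                       ∎
    where
    toℕ-next-v : toℕ (next v) ≡ suc (toℕ v)
    toℕ-next-v = toℕ-next-< (m<n⇒m<1+n (m<n⇒m<1+n (s≤s v<)))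
    next< : toℕ (next v) < 2 + 2 * t
    next< = subst (_< 2 + 2 * t) (sym toℕ-next-v) (s≤s v<)

  weight-before-penultimate : ∀ {v} → toℕ v ≡ 1 + 2 * t → W v ≡ 2 * (3 + 2 * t)
  weight-before-penultimate {v} v≡ = begin
    W v                              ≡⟨ weight-01 (s≤s (s≤s z≤n)) σ v ⟩
    label σ v + label σ (next v)     ≡⟨ cong₂ _+_ (label-initial (≤-reflexive (cong suc v≡))) (label-penultimate toℕ-next-v) ⟩
    suc (toℕ v) + (4 + 2 * t)        ≡⟨ cong (λ x → suc x + (4 + 2 * t)) v≡ ⟩
    (2 + 2 * t) + (4 + 2 * t)        ≡⟨ [2+2*m]+[4+2*m]≡2*[3+2*m] t ⟩
    2 * (3 + 2 * t)                  ∎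
    where
    toℕ-next-v : toℕ (next v) ≡ 2 + 2 * t
    toℕ-next-v = trans (toℕ-next-< (subst (λ x → suc x < n) (sym v≡) (m<n⇒m<1+n (n<1+n _)))) (cong suc v≡)

  weight-penultimate : ∀ {v} → toℕ v ≡ 2 + 2 * t → W v ≡ 3 + 2 * toℕ v
  weight-penultimate {v} v≡ = begin
    W v                              ≡⟨ weight-01 (s≤s (s≤s z≤n)) σ v ⟩
    label σ v + label σ (next v)     ≡⟨ cong₂ _+_ (label-penultimate v≡) (label-last toℕ-next-v) ⟩
    (4 + 2 * t) + (3 + 2 * t)        ≡⟨ [4+2*m]+[3+2*m]≡3+2*[2+2*m] t ⟩
    3 + 2 * (2 + 2 * t)              ≡⟨ cong (λ x → 3 + 2 * x) v≡ ⟨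
    3 + 2 * toℕ v                    ∎
    where
    toℕ-next-v : toℕ (next v) ≡ 3 + 2 * t
    toℕ-next-v = trans (toℕ-next-< (subst (λ x → suc x < n) (sym v≡) (n<1+n _))) (cong suc v≡)

  weight-last : ∀ {v} → toℕ v ≡ 3 + 2 * t → W v ≡ 2 * (2 + t)
  weight-last {v} v≡ = begin
    W v                              ≡⟨ weight-01 (s≤s (s≤s z≤n)) σ v ⟩
    label σ v + label σ (next v)     ≡⟨ cong₂ _+_ (label-last v≡) (label-initial (subst (_< 2 + 2 * t) (sym toℕ-next-v) (s≤s z≤n))) ⟩
    (3 + 2 * t) + suc (toℕ (next v)) ≡⟨ cong (λ x → (3 + 2 * t) + suc x) toℕ-next-v ⟩
    (3 + 2 * t) + 1                  ≡⟨ 3+2*m+1≡2*[2+m] t ⟩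
    2 * (2 + t)                      ∎
    where
    toℕ-next-v : toℕ (next v) ≡ 0
    toℕ-next-v = toℕ-next-last (cong suc v≡)

  decode : ℕ → ℕ
  decode h = if does (h ≟ 2 + t) then 3 + 2 * t else 1 + 2 * t

  decode-2+t : decode (2 + t) ≡ 3 + 2 * t
  decode-2+t = cong (if_then 3 + 2 * t else 1 + 2 * t) (dec-true (2 + t ≟ 2 + t) refl)

  decode-3+2t : decode (3 + 2 * t) ≡ 1 + 2 * t
  decode-3+2t = cong (if_then 3 + 2 * t else 1 + 2 * t) (dec-false (3 + 2 * t ≟ 2 + t) (>⇒≢ 2+t<3+2t))
    where
    2+t<3+2t : 2 + t < 3 + 2 * t
    2+t<3+2t = +-monoʳ-< 2 (s≤s (m≤n*m t 2))

  classify : ∀ v → W v ≡ 3 + 2 * toℕ v ⊎ ∃[ h ] (W v ≡ 2 * h × toℕ v ≡ decode h)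
  classify v with ≤2+-cases {toℕ v} {1 + 2 * t} (s≤s⁻¹ (toℕ<n v))
  ... | inj₁ v<                 = inj₁ (weight-initial v<)
  ... | inj₂ (inj₁ v≡)          = inj₂ (3 + 2 * t , weight-before-penultimate v≡ , trans v≡ (sym decode-3+2t))
  ... | inj₂ (inj₂ (inj₁ v≡))   = inj₁ (weight-penultimate v≡)
  ... | inj₂ (inj₂ (inj₂ v≡))   = inj₂ (2 + t , weight-last v≡ , trans v≡ (sym decode-2+t))

mainTheorem16 : (m : ℕ) → CycleDAntimagic (3 + m) (0 ∷ 1 ∷ [])
mainTheorem16 m with even⊎odd m
... | inj₁ (t , refl) = odd-cycle-01-antimagic t
... | inj₂ (t , refl) = even-cycle-01-antimagic t
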